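{- For integers $n,m\geq 1$ that are not both even, one has the coefficientwise inequality $F_n(y)F_m(y)\leq F_{n+m-1}(y)$ in $\mathbb{Z}[y]$.
   Context: The polynomials $F_n(y)\in\mathbb{Z}[y]$ are defined by $F_0(y)=0$, $F_1(y)=1$, and for $n\geq2$: $F_n(y)=F_{n-1}(y)+F_{n-2}(y)$ if $n$ is even, $F_n(y)=F_{n-1}(y)+yF_{n-2}(y)$ if $n$ is odd. Coefficientwise inequality $f\leq g$ means every coefficient of $g-f$ is nonnegative. -}

module Defs where

open import Data.Nat using (ℕ; zero; suc)
open import Data.Integer using (ℤ; 0ℤ; 1ℤ; _+_; _*_; _≤_)
open import Data.List using (List; []; _∷_)

-- Polynomials in ℤ[y] as coefficient lists, lowest degree first:
-- a₀ ∷ a₁ ∷ … represents a₀ + a₁ y + …  (trailing zeros allowed).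
Poly : Set
Poly = List ℤ

coeff : Poly → ℕ → ℤ
coeff []       _       = 0ℤ
coeff (a ∷ p)  zero    = a
coeff (a ∷ p)  (suc k) = coeff p k

infixl 6 _⊕_
_⊕_ : Poly → Poly → Poly
[]      ⊕ q       = q
(a ∷ p) ⊕ []      = a ∷ p
(a ∷ p) ⊕ (b ∷ q) = (a + b) ∷ (p ⊕ q)

_·_ : ℤ → Poly → Poly
c · []      = []
c · (a ∷ p) = (c * a) ∷ (c · p)

yMul : Poly → Poly
yMul p = 0ℤ ∷ p

infixl 7 _⊗_
_⊗_ : Poly → Poly → Poly
[]      ⊗ q = []
(a ∷ p) ⊗ q = (a · q) ⊕ yMul (p ⊗ q)

_≤ᶜ_ : Poly → Poly → Set
f ≤ᶜ g = ∀ k → coeff f k ≤ coeff g k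

-- F₀ = 0, F₁ = 1, and for n ≥ 2:
--   F n = F (n-1) + F (n-2)     if n is even,
--   F n = F (n-1) + y F (n-2)   if n is odd.
-- Written with n = k + 2: n even iff k even.
mutual
  F : ℕ → Poly
  F zero          = []
  F (suc zero)    = 1ℤ ∷ []
  F (suc (suc k)) = Fstep k (F (suc k)) (F k)

  Fstep : ℕ → Poly → Poly → Poly
  Fstep zero          a b = a ⊕ b
  Fstep (suc zero)    a b = a ⊕ yMul b
  Fstep (suc (suc k)) a b = Fstep k a b

-- Multiplication by F (e + 1), on either side, is additive and commutes with
-- multiplication by y. For even e the shifted sequence F (e + n) obeys the same
-- recurrence Fₙ₊₂ = Fₙ₊₁ + y^[n odd] Fₙ as Fₙ, because the recurrence only sees the
-- parity of n. Hence any such map L with L 1 = F (e + 1) satisfies L Fₙ ≤ F (e + n)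
-- by induction on n: at n = 0 since L 0 = 0 and every Fₙ has nonnegative
-- coefficients, at n = 1 by assumption, and the step only adds and multiplies by y.
-- If n and m are not both even, one of them is e + 1 with e even.
module Submission where

open import Defs
open import Data.Nat using (ℕ; zero; suc; _+_; _*_; _∸_; _≥_; z≤n)
import Data.Nat.Properties as ℕ
open import Data.Nat.Divisibility using (_∣_; divides; ∣-refl; ∣m∣n⇒∣m+n)
open import Data.Integer using (0ℤ; 1ℤ; +≤+)
  renaming (_+_ to _+ℤ_; _*_ to _*ℤ_; _≤_ to _≤ℤ_)
import Data.Integer.Properties as ℤ
open import Data.Integer.Tactic.RingSolver using (solve-∀)
open import Data.List using ([]; _∷_)
open import Data.Product using (_×_; _,_; ∃-syntax)
open import Data.Sum using (_⊎_; inj₁; inj₂)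
open import Data.Empty using (⊥-elim)
open import Relation.Nullary using (¬_)
open import Relation.Binary.Bundles using (Preorder)
open import Relation.Binary.PropositionalEquality
import Relation.Binary.Reasoning.Preorder as PreorderReasoning

infix 4 _≈ᶜ_
_≈ᶜ_ : Poly → Poly → Set
p ≈ᶜ q = ∀ k → coeff p k ≡ coeff q k

≤ᶜ-preorder : Preorder _ _ _
≤ᶜ-preorder = record
  { Carrier    = Poly
  ; _≈_        = _≈ᶜ_
  ; _≲_        = _≤ᶜ_
  ; isPreorder = record
    { isEquivalence = record
      { refl  = λ _ → refl
      ; sym   = λ p≈q k → sym (p≈q k)
      ; trans = λ p≈q q≈r k → trans (p≈q k) (q≈r k)
      }
    ; reflexive = λ p≈q k → ℤ.≤-reflexive (p≈q k)
    ; trans     = λ p≤q q≤r k → ℤ.≤-trans (p≤q k) (q≤r k)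
    }
  }

module ≤ᶜ-Reasoning = PreorderReasoning ≤ᶜ-preorder

coeff-⊕ : ∀ p q k → coeff (p ⊕ q) k ≡ coeff p k +ℤ coeff q k
coeff-⊕ []      q       k       = sym (ℤ.+-identityˡ _)
coeff-⊕ (a ∷ p) []      k       = sym (ℤ.+-identityʳ _)
coeff-⊕ (a ∷ p) (b ∷ q) zero    = refl
coeff-⊕ (a ∷ p) (b ∷ q) (suc k) = coeff-⊕ p q k

coeff-· : ∀ c p k → coeff (c · p) k ≡ c *ℤ coeff p k
coeff-· c []      k       = sym (ℤ.*-zeroʳ c)
coeff-· c (a ∷ p) zero    = refl
coeff-· c (a ∷ p) (suc k) = coeff-· c p k

coeff-⊗-∷ : ∀ a p q k → coeff ((a ∷ p) ⊗ q) k ≡ a *ℤ coeff q k +ℤ coeff (yMul (p ⊗ q)) k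
coeff-⊗-∷ a p q k = trans (coeff-⊕ (a · q) (yMul (p ⊗ q)) k)
                          (cong (_+ℤ coeff (yMul (p ⊗ q)) k) (coeff-· a q k))

⊕-cong : ∀ {p p′ q q′} → p ≈ᶜ p′ → q ≈ᶜ q′ → p ⊕ q ≈ᶜ p′ ⊕ q′
⊕-cong {p} {p′} {q} {q′} p≈p′ q≈q′ k = begin
  coeff (p ⊕ q) k          ≡⟨ coeff-⊕ p q k ⟩
  coeff p k +ℤ coeff q k   ≡⟨ cong₂ _+ℤ_ (p≈p′ k) (q≈q′ k) ⟩
  coeff p′ k +ℤ coeff q′ k ≡⟨ coeff-⊕ p′ q′ k ⟨
  coeff (p′ ⊕ q′) k        ∎
  where open ≡-Reasoning

⊕-mono : ∀ {p p′ q q′} → p ≤ᶜ p′ → q ≤ᶜ q′ → (p ⊕ q) ≤ᶜ (p′ ⊕ q′)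
⊕-mono {p} {p′} {q} {q′} p≤p′ q≤q′ k =
  subst₂ _≤ℤ_ (sym (coeff-⊕ p q k)) (sym (coeff-⊕ p′ q′ k))
         (ℤ.+-mono-≤ (p≤p′ k) (q≤q′ k))

yMul-cong : ∀ {p q} → p ≈ᶜ q → yMul p ≈ᶜ yMul q
yMul-cong p≈q zero    = refl
yMul-cong p≈q (suc k) = p≈q k

yMul-mono : ∀ {p q} → p ≤ᶜ q → yMul p ≤ᶜ yMul q
yMul-mono p≤q zero    = ℤ.≤-refl
yMul-mono p≤q (suc k) = p≤q k

*-distribʳ-+-interchange : ∀ a b x u v →
  (a +ℤ b) *ℤ x +ℤ (u +ℤ v) ≡ (a *ℤ x +ℤ u) +ℤ (b *ℤ x +ℤ v)
*-distribʳ-+-interchange = solve-∀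

*-distribˡ-+-interchange : ∀ c x y u v →
  c *ℤ (x +ℤ y) +ℤ (u +ℤ v) ≡ (c *ℤ x +ℤ u) +ℤ (c *ℤ y +ℤ v)
*-distribˡ-+-interchange = solve-∀

⊗-distribʳ-⊕ : ∀ p r q → ((p ⊕ r) ⊗ q) ≈ᶜ ((p ⊗ q) ⊕ (r ⊗ q))
⊗-distribʳ-⊕ []      r       q k = refl
⊗-distribʳ-⊕ (a ∷ p) []      q k = sym (trans (coeff-⊕ ((a ∷ p) ⊗ q) [] k) (ℤ.+-identityʳ _))
⊗-distribʳ-⊕ (a ∷ p) (b ∷ r) q k = begin
  coeff (((a +ℤ b) ∷ (p ⊕ r)) ⊗ q) k
    ≡⟨ coeff-⊗-∷ (a +ℤ b) (p ⊕ r) q k ⟩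
  (a +ℤ b) *ℤ coeff q k +ℤ coeff (yMul ((p ⊕ r) ⊗ q)) k
    ≡⟨ cong ((a +ℤ b) *ℤ coeff q k +ℤ_) (trans (yMul-cong (⊗-distribʳ-⊕ p r q) k)
                                               (coeff-⊕ (yMul (p ⊗ q)) (yMul (r ⊗ q)) k)) ⟩
  (a +ℤ b) *ℤ coeff q k +ℤ (coeff (yMul (p ⊗ q)) k +ℤ coeff (yMul (r ⊗ q)) k)
    ≡⟨ *-distribʳ-+-interchange a b _ _ _ ⟩
  (a *ℤ coeff q k +ℤ coeff (yMul (p ⊗ q)) k) +ℤ (b *ℤ coeff q k +ℤ coeff (yMul (r ⊗ q)) k)
    ≡⟨ cong₂ _+ℤ_ (coeff-⊗-∷ a p q k) (coeff-⊗-∷ b r q k) ⟨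
  coeff ((a ∷ p) ⊗ q) k +ℤ coeff ((b ∷ r) ⊗ q) k
    ≡⟨ coeff-⊕ ((a ∷ p) ⊗ q) ((b ∷ r) ⊗ q) k ⟨
  coeff (((a ∷ p) ⊗ q) ⊕ ((b ∷ r) ⊗ q)) k ∎
  where open ≡-Reasoning

⊗-distribˡ-⊕ : ∀ p a b → (p ⊗ (a ⊕ b)) ≈ᶜ ((p ⊗ a) ⊕ (p ⊗ b))
⊗-distribˡ-⊕ []      a b k = refl
⊗-distribˡ-⊕ (c ∷ p) a b k = begin
  coeff ((c ∷ p) ⊗ (a ⊕ b)) k
    ≡⟨ coeff-⊗-∷ c p (a ⊕ b) k ⟩
  c *ℤ coeff (a ⊕ b) k +ℤ coeff (yMul (p ⊗ (a ⊕ b))) k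
    ≡⟨ cong₂ _+ℤ_ (cong (c *ℤ_) (coeff-⊕ a b k))
                  (trans (yMul-cong (⊗-distribˡ-⊕ p a b) k) (coeff-⊕ (yMul (p ⊗ a)) (yMul (p ⊗ b)) k)) ⟩
  c *ℤ (coeff a k +ℤ coeff b k) +ℤ (coeff (yMul (p ⊗ a)) k +ℤ coeff (yMul (p ⊗ b)) k)
    ≡⟨ *-distribˡ-+-interchange c _ _ _ _ ⟩
  (c *ℤ coeff a k +ℤ coeff (yMul (p ⊗ a)) k) +ℤ (c *ℤ coeff b k +ℤ coeff (yMul (p ⊗ b)) k)
    ≡⟨ cong₂ _+ℤ_ (coeff-⊗-∷ c p a k) (coeff-⊗-∷ c p b k) ⟨
  coeff ((c ∷ p) ⊗ a) k +ℤ coeff ((c ∷ p) ⊗ b) k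
    ≡⟨ coeff-⊕ ((c ∷ p) ⊗ a) ((c ∷ p) ⊗ b) k ⟨
  coeff (((c ∷ p) ⊗ a) ⊕ ((c ∷ p) ⊗ b)) k ∎
  where open ≡-Reasoning

⊗-yMulˡ : ∀ p q → (yMul p ⊗ q) ≈ᶜ yMul (p ⊗ q)
⊗-yMulˡ p q k = begin
  coeff (yMul p ⊗ q) k                            ≡⟨ coeff-⊗-∷ 0ℤ p q k ⟩
  0ℤ *ℤ coeff q k +ℤ coeff (yMul (p ⊗ q)) k       ≡⟨ cong (_+ℤ coeff (yMul (p ⊗ q)) k) (ℤ.*-zeroˡ (coeff q k)) ⟩
  0ℤ +ℤ coeff (yMul (p ⊗ q)) k                    ≡⟨ ℤ.+-identityˡ _ ⟩
  coeff (yMul (p ⊗ q)) k                          ∎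
  where open ≡-Reasoning

⊗-yMulʳ : ∀ p q → (p ⊗ yMul q) ≈ᶜ yMul (p ⊗ q)
⊗-yMulʳ []      q zero    = refl
⊗-yMulʳ []      q (suc k) = refl
⊗-yMulʳ (c ∷ p) q zero    = trans (ℤ.+-identityʳ _) (ℤ.*-zeroʳ c)
⊗-yMulʳ (c ∷ p) q (suc k) = ⊕-cong {c · q} {c · q} (λ _ → refl) (⊗-yMulʳ p q) k

⊗-identityˡ : ∀ q → ((1ℤ ∷ []) ⊗ q) ≈ᶜ q
⊗-identityˡ q k = begin
  coeff ((1ℤ ∷ []) ⊗ q) k                ≡⟨ coeff-⊗-∷ 1ℤ [] q k ⟩
  1ℤ *ℤ coeff q k +ℤ coeff (yMul []) k   ≡⟨ cong₂ _+ℤ_ (ℤ.*-identityˡ (coeff q k)) (yMul-[] k) ⟩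
  coeff q k +ℤ 0ℤ                        ≡⟨ ℤ.+-identityʳ _ ⟩
  coeff q k                              ∎
  where
  open ≡-Reasoning
  yMul-[] : ∀ k → coeff (yMul []) k ≡ 0ℤ
  yMul-[] zero    = refl
  yMul-[] (suc k) = refl

⊗-identityʳ : ∀ p → (p ⊗ (1ℤ ∷ [])) ≈ᶜ p
⊗-identityʳ []      k       = refl
⊗-identityʳ (c ∷ p) zero    = trans (ℤ.+-identityʳ _) (ℤ.*-identityʳ c)
⊗-identityʳ (c ∷ p) (suc k) = ⊗-identityʳ p k

⊗-zeroʳ : ∀ p → (p ⊗ []) ≈ᶜ []
⊗-zeroʳ []      k       = refl
⊗-zeroʳ (c ∷ p) zero    = refl
⊗-zeroʳ (c ∷ p) (suc k) = ⊗-zeroʳ p k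

record IsYLinear (L : Poly → Poly) : Set where
  field
    map-[]   : L [] ≈ᶜ []
    map-⊕    : ∀ p q → L (p ⊕ q) ≈ᶜ (L p ⊕ L q)
    map-yMul : ∀ p → L (yMul p) ≈ᶜ yMul (L p)

⊗ʳ-isYLinear : ∀ q → IsYLinear (_⊗ q)
⊗ʳ-isYLinear q = record
  { map-[]   = λ _ → refl
  ; map-⊕    = λ p r → ⊗-distribʳ-⊕ p r q
  ; map-yMul = λ p → ⊗-yMulˡ p q
  }

⊗ˡ-isYLinear : ∀ p → IsYLinear (p ⊗_)
⊗ˡ-isYLinear p = record
  { map-[]   = ⊗-zeroʳ p
  ; map-⊕    = ⊗-distribˡ-⊕ p
  ; map-yMul = ⊗-yMulʳ p
  }

map-Fstep : ∀ {L} → IsYLinear L → ∀ k a b → L (Fstep k a b) ≈ᶜ Fstep k (L a) (L b)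
map-Fstep lin zero          a b = map-⊕ a b
  where open IsYLinear lin
map-Fstep {L} lin (suc zero) a b k =
  trans (map-⊕ a (yMul b) k) (⊕-cong {L a} {L a} (λ _ → refl) (map-yMul b) k)
  where open IsYLinear lin
map-Fstep lin (suc (suc k)) a b = map-Fstep lin k a b

Fstep-mono : ∀ k {a a′ b b′} → a ≤ᶜ a′ → b ≤ᶜ b′ → Fstep k a b ≤ᶜ Fstep k a′ b′
Fstep-mono zero       {a} {a′} {b} {b′} a≤a′ b≤b′ = ⊕-mono {a} {a′} {b} {b′} a≤a′ b≤b′
Fstep-mono (suc zero) {a} {a′} {b} {b′} a≤a′ b≤b′ =
  ⊕-mono {a} {a′} {yMul b} {yMul b′} a≤a′ (yMul-mono {b} {b′} b≤b′)
Fstep-mono (suc (suc k)) a≤a′ b≤b′ = Fstep-mono k a≤a′ b≤b′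

Fstep-nonneg : ∀ k {a b} → [] ≤ᶜ a → [] ≤ᶜ b → [] ≤ᶜ Fstep k a b
Fstep-nonneg zero       {a} {b} 0≤a 0≤b = ⊕-mono {[]} {a} {[]} {b} 0≤a 0≤b
Fstep-nonneg (suc zero) {a} {b} 0≤a 0≤b = ⊕-mono {[]} {a} {[]} {yMul b} 0≤a 0≤yMul
  where
  0≤yMul : [] ≤ᶜ yMul b
  0≤yMul zero    = ℤ.≤-refl
  0≤yMul (suc k) = 0≤b k
Fstep-nonneg (suc (suc k)) 0≤a 0≤b = Fstep-nonneg k 0≤a 0≤b

F-nonneg : ∀ n → [] ≤ᶜ F n
F-nonneg zero          k       = ℤ.≤-refl
F-nonneg (suc zero)    zero    = +≤+ z≤n
F-nonneg (suc zero)    (suc k) = ℤ.≤-refl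
F-nonneg (suc (suc n))         = Fstep-nonneg n (F-nonneg (suc n)) (F-nonneg n)

Fstep-+-even : ∀ {e} → 2 ∣ e → ∀ k a b → Fstep (e + k) a b ≡ Fstep k a b
Fstep-+-even (divides q refl) = shift q
  where
  shift : ∀ q k a b → Fstep (q * 2 + k) a b ≡ Fstep k a b
  shift zero    k a b = refl
  shift (suc q)       = shift q

F-+-even : ∀ {e} → 2 ∣ e → ∀ k → F (e + suc (suc k)) ≡ Fstep k (F (e + suc k)) (F (e + k))
F-+-even {e} e-even k rewrite ℕ.+-suc e (suc k) | ℕ.+-suc e k =
  Fstep-+-even e-even k (F (suc (e + k))) (F (e + k))

map-F≤ᶜF-+ : ∀ {L e} → IsYLinear L → 2 ∣ e → L (1ℤ ∷ []) ≈ᶜ F (suc e) →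
  ∀ n → L (F n) ≤ᶜ F (e + n)
map-F≤ᶜF-+ {L} {e} lin e-even L1≈F[1+e] = bound
  where
  open IsYLinear lin
  open ≤ᶜ-Reasoning
  bound : ∀ n → L (F n) ≤ᶜ F (e + n)
  bound zero = begin
    L []      ≈⟨ map-[] ⟩
    []        ≲⟨ F-nonneg (e + 0) ⟩
    F (e + 0) ∎
  bound (suc zero) = begin
    L (1ℤ ∷ []) ≈⟨ L1≈F[1+e] ⟩
    F (suc e)   ≡⟨ cong F (ℕ.+-comm 1 e) ⟩
    F (e + 1)   ∎
  bound (suc (suc k)) = begin
    L (Fstep k (F (suc k)) (F k))         ≈⟨ map-Fstep lin k (F (suc k)) (F k) ⟩
    Fstep k (L (F (suc k))) (L (F k))     ≲⟨ Fstep-mono k (bound (suc k)) (bound k) ⟩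
    Fstep k (F (e + suc k)) (F (e + k))   ≡⟨ F-+-even e-even k ⟨
    F (e + suc (suc k))                   ∎

even-or-odd : ∀ n → 2 ∣ n ⊎ ∃[ e ] (2 ∣ e × n ≡ suc e)
even-or-odd zero = inj₁ (divides 0 refl)
even-or-odd (suc n) with even-or-odd n
... | inj₁ n-even                = inj₂ (n , n-even , refl)
... | inj₂ (e , e-even , refl)   = inj₁ (∣m∣n⇒∣m+n ∣-refl e-even)

lemma6p3 : (n m : ℕ) → n ≥ 1 → m ≥ 1 → ¬ (2 ∣ n × 2 ∣ m) →
    (F n ⊗ F m) ≤ᶜ F (n + m ∸ 1)
lemma6p3 n m _ _ not-both-even with even-or-odd n | even-or-odd m
... | inj₁ n-even | inj₁ m-even = ⊥-elim (not-both-even (n-even , m-even))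
... | inj₂ (e , e-even , refl) | _ =
  map-F≤ᶜF-+ (⊗ˡ-isYLinear (F (suc e))) e-even (⊗-identityʳ (F (suc e))) m
... | inj₁ _ | inj₂ (e , e-even , refl) rewrite ℕ.+-suc n e | ℕ.+-comm n e =
  map-F≤ᶜF-+ (⊗ʳ-isYLinear (F (suc e))) e-even (⊗-identityˡ (F (suc e))) n
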